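{- Let $\sigma,\omega\in S_\infty$ with $\sigma<_{\mathrm{Bruhat}}\omega$. Then $(d(\sigma,\omega),m(\sigma,\omega))$ is a relative candidate for $\sigma,\omega$.
   Context: $S_\infty$ is the group of bijections $\mathbb N\to\mathbb N$. Bruhat order: $\sigma\le_{\mathrm{Bruhat}}\omega$ iff for every $n$, the $i$-th smallest element of $\{\sigma(1),\dots,\sigma(n)\}$ is at most the $i$-th smallest of $\{\omega(1),\dots,\omega(n)\}$ for all $i$; $\lessdot_{\mathrm{Bruhat}}$ is the cover relation. For $\sigma\ne\omega$, $d(\sigma,\omega)$ is the least $n$ with $\sigma(n)\ne\omega(n)$. When $\sigma<_{\mathrm{Bruhat}}\omega$, with $d=d(\sigma,\omega)$ one has $\sigma(d)<\omega(d)$; set $f(\sigma,\omega)=\sigma^{ -1}(\omega(d))$ (so $d<f$, $\sigma(d)<\sigma(f)$) and let $m(\sigma,\omega)$ be the least $m$ with $d<m\le f$ and $\sigma(d)<\sigma(m)\le\sigma(f)$. A transposition $(p,q)$, $p<q$, is a relative candidate for $\sigma,\omega$ if $\sigma\lessdot_{\mathrm{Bruhat}}\sigma\circ(p,q)\le_{\mathrm{Bruhat}}\omega$. -}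

module Defs where

open import Data.Nat using (ℕ; zero; suc; _≤_; _<_; _≟_)
open import Data.Nat.Properties using (≤-decTotalOrder)
open import Data.List using (List; map; upTo)
open import Data.List.Relation.Binary.Pointwise using (Pointwise)
open import Data.List.Sort.MergeSort ≤-decTotalOrder using (mergeSort)
open import Data.List.Sort.Base using (SortingAlgorithm)
open import Data.Product using (_×_)
open import Data.Empty using (⊥)
open import Relation.Nullary using (¬_; yes; no)
open import Relation.Binary.PropositionalEquality using (_≡_)
open import Function.Bundles using (_↔_; Inverse)

-- Positions and values are indexed from 0 (Agda's ℕ); this is an
-- order-preserving relabelling of the paper's ℕ = {1,2,...}.

S∞ : Set
S∞ = ℕ ↔ ℕ

⟦_⟧ : S∞ → ℕ → ℕ
⟦ σ ⟧ = Inverse.to σ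

_⁻¹⟦_⟧ : S∞ → ℕ → ℕ
σ ⁻¹⟦ x ⟧ = Inverse.from σ x

sortedPrefix : (ℕ → ℕ) → ℕ → List ℕ
sortedPrefix σ n = SortingAlgorithm.sort mergeSort (map σ (upTo n))

_≤B_ : (ℕ → ℕ) → (ℕ → ℕ) → Set
σ ≤B ω = ∀ n → Pointwise _≤_ (sortedPrefix σ n) (sortedPrefix ω n)

_<B_ : (ℕ → ℕ) → (ℕ → ℕ) → Set
σ <B ω = σ ≤B ω × ¬ (∀ n → σ n ≡ ω n)

_⋖B_ : (ℕ → ℕ) → (ℕ → ℕ) → Set
σ ⋖B τ = σ <B τ × (∀ (ρ : S∞) → σ <B ⟦ ρ ⟧ → ⟦ ρ ⟧ <B τ → ⊥)

swap : ℕ → ℕ → ℕ → ℕ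
swap p q x with x ≟ p
... | yes _ = q
... | no _ with x ≟ q
...   | yes _ = p
...   | no _ = x

_∘t[_,_] : (ℕ → ℕ) → ℕ → ℕ → ℕ → ℕ
(σ ∘t[ p , q ]) x = σ (swap p q x)

RelativeCandidate : S∞ → S∞ → ℕ → ℕ → Set
RelativeCandidate σ ω p q =
  p < q × (⟦ σ ⟧ ⋖B (⟦ σ ⟧ ∘t[ p , q ])) × ((⟦ σ ⟧ ∘t[ p , q ]) ≤B ⟦ ω ⟧)

IsLeast : (ℕ → Set) → ℕ → Set
IsLeast P n = P n × (∀ k → k < n → ¬ P k)

IsD : S∞ → S∞ → ℕ → Set
IsD σ ω = IsLeast (λ n → ¬ (⟦ σ ⟧ n ≡ ⟦ ω ⟧ n))

fOf : S∞ → S∞ → ℕ → ℕ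
fOf σ ω d = σ ⁻¹⟦ ⟦ ω ⟧ d ⟧

IsM : S∞ → S∞ → ℕ → ℕ → Set
IsM σ ω d = IsLeast (λ m → (d < m × m ≤ fOf σ ω d) ×
                           (⟦ σ ⟧ d < ⟦ σ ⟧ m × ⟦ σ ⟧ m ≤ ⟦ σ ⟧ (fOf σ ω d)))

-- Bruhat order is a comparison of ranks, rank f n v = #{ i < n | v ≤ f i }: f ≤B g iff
-- rank f n v ≤ rank g n v for all n, v.  With a = σ d < b = σ m and τ = σ ∘ (d,m), rank τ
-- exceeds rank σ by exactly one on the box d < n ≤ m, a < v ≤ b and equals it elsewhere.
-- Minimality of m says that no σ i with d < i < m lies in (a, σ f].
-- Cover: a permutation ρ strictly between σ and τ has the ranks of σ off the box, which forces
-- ρ i = σ i for i ∉ {d, m}; so ρ is σ or τ.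
-- τ ≤ ω: on the box, the positions d ≤ i < n carry no value of σ in [v, σ f] but carry the
-- value ω d = σ f of ω; since σ and ω agree before d and rank σ ≤ rank ω at the threshold
-- σ f + 1, this gives rank σ n v < rank ω n v.
{-# OPTIONS --safe #-}
module Submission where

open import Defs
open import Data.Nat using (ℕ; zero; suc; _+_; _∸_; _≤_; _<_; z≤n; s≤s; z<s)
open import Data.Nat.Properties
open import Algebra.Properties.CommutativeSemigroup +-commutativeSemigroup using (xy∙z≈xz∙y)
open import Data.Nat.ListAction using (sum)
open import Data.Nat.ListAction.Properties using (sum-↭; sum-++)
open import Data.List using (List; []; _∷_; [_]; _++_; map; upTo; length)
open import Data.List.Properties using (upTo-∷ʳ; map-++; length-map; length-upTo)
open import Data.List.Relation.Binary.Pointwise using (Pointwise; []; _∷_)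
open import Data.List.Relation.Binary.Permutation.Propositional using (_↭_)
open import Data.List.Relation.Binary.Permutation.Propositional.Properties using (map⁺; ↭-length)
open import Data.List.Relation.Unary.All as All using (All; []; _∷_)
open import Data.List.Relation.Unary.Linked as Linked using (Linked)
open import Data.List.Relation.Unary.Linked.Properties using (Linked⇒All)
open import Data.List.Sort.MergeSort ≤-decTotalOrder using (mergeSort)
open import Data.List.Sort.Base using (SortingAlgorithm)
open import Data.Product using (_×_; _,_)
open import Data.Empty using (⊥)
open import Data.Sum as Sum using (_⊎_; inj₁; inj₂)
open import Function using (_∘_)
open import Function.Bundles using (Inverse; Injection)
open import Function.Properties.Inverse using (↔⇒↣)
open import Relation.Binary.Definitions using (tri<; tri≈; tri>)
open import Relation.Binary.PropositionalEquality
  using (_≡_; _≢_; _≗_; refl; sym; trans; cong; cong₂; subst; subst₂; module ≡-Reasoning)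
open import Relation.Nullary using (¬_; Dec; yes; no; contradiction)
open import Relation.Nullary.Decidable using (_×-dec_; decidable-stable)

open SortingAlgorithm mergeSort using (sort-↭; sort-↗)

𝟙[_≤_] : ℕ → ℕ → ℕ
𝟙[ v ≤ x ] with v ≤? x
... | yes _ = 1
... | no _ = 0

𝟙-≤ : ∀ {v x} → v ≤ x → 𝟙[ v ≤ x ] ≡ 1
𝟙-≤ {v} {x} v≤x with v ≤? x
... | yes _ = refl
... | no v≰x = contradiction v≤x v≰x

𝟙-> : ∀ {v x} → x < v → 𝟙[ v ≤ x ] ≡ 0
𝟙-> {v} {x} x<v with v ≤? x
... | yes v≤x = contradiction v≤x (<⇒≱ x<v)
... | no _ = refl

𝟙≡1⇒≤ : ∀ {v x} → 𝟙[ v ≤ x ] ≡ 1 → v ≤ x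
𝟙≡1⇒≤ {v} {x} 𝟙≡1 with v ≤? x
... | yes v≤x = v≤x
... | no _ = contradiction 𝟙≡1 0≢1+n

𝟙≡0⇒> : ∀ {v x} → 𝟙[ v ≤ x ] ≡ 0 → x < v
𝟙≡0⇒> {v} {x} 𝟙≡0 with v ≤? x
... | yes _ = contradiction 𝟙≡0 1+n≢0
... | no v≰x = ≰⇒> v≰x

𝟙-monoʳ-≤ : ∀ v {x y} → x ≤ y → 𝟙[ v ≤ x ] ≤ 𝟙[ v ≤ y ]
𝟙-monoʳ-≤ v {x} x≤y with v ≤? x
... | yes v≤x = ≤-reflexive (sym (𝟙-≤ (≤-trans v≤x x≤y)))
... | no _ = z≤n

𝟙-antimonoˡ-≤ : ∀ {v w} x → v ≤ w → 𝟙[ w ≤ x ] ≤ 𝟙[ v ≤ x ]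
𝟙-antimonoˡ-≤ {w = w} x v≤w with w ≤? x
... | yes w≤x = ≤-reflexive (sym (𝟙-≤ (≤-trans v≤w w≤x)))
... | no _ = z≤n

𝟙≡𝟙⇒≡ : ∀ {x y} → 𝟙[ x ≤ y ] ≡ 𝟙[ x ≤ x ] → 𝟙[ suc x ≤ y ] ≡ 𝟙[ suc x ≤ x ] → y ≡ x
𝟙≡𝟙⇒≡ 𝟙≡𝟙 𝟙≡𝟙′ =
  ≤-antisym (m<1+n⇒m≤n (𝟙≡0⇒> (trans 𝟙≡𝟙′ (𝟙-> ≤-refl)))) (𝟙≡1⇒≤ (trans 𝟙≡𝟙 (𝟙-≤ ≤-refl)))

count : ℕ → List ℕ → ℕ
count v xs = sum (map 𝟙[ v ≤_] xs)

count-↭ : ∀ v {xs ys} → xs ↭ ys → count v xs ≡ count v ys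
count-↭ v xs↭ys = sum-↭ (map⁺ 𝟙[ v ≤_] xs↭ys)

count-++ : ∀ v xs ys → count v (xs ++ ys) ≡ count v xs + count v ys
count-++ v xs ys = trans (cong sum (map-++ 𝟙[ v ≤_] xs ys)) (sum-++ (map 𝟙[ v ≤_] xs) _)

count-mono : ∀ v {xs ys} → Pointwise _≤_ xs ys → count v xs ≤ count v ys
count-mono v [] = z≤n
count-mono v (x≤y ∷ xs≤ys) = +-mono-≤ (𝟙-monoʳ-≤ v x≤y) (count-mono v xs≤ys)

count≤length : ∀ v xs → count v xs ≤ length xs
count≤length v [] = z≤n
count≤length v (x ∷ xs) with v ≤? x
... | yes _ = s≤s (count≤length v xs)
... | no _ = m≤n⇒m≤1+n (count≤length v xs)

count-all : ∀ {v xs} → All (v ≤_) xs → count v xs ≡ length xs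
count-all [] = refl
count-all (v≤x ∷ v≤xs) = cong₂ _+_ (𝟙-≤ v≤x) (count-all v≤xs)

count≤⇒pointwise : ∀ {xs ys} → Linked _≤_ xs → Linked _≤_ ys → length xs ≡ length ys →
                   (∀ v → count v xs ≤ count v ys) → Pointwise _≤_ xs ys
count≤⇒pointwise {[]} {[]} _ _ _ _ = []
count≤⇒pointwise {x ∷ xs} {y ∷ ys} ↗xs ↗ys |xs|≡|ys| counts≤ =
  x≤y ∷ count≤⇒pointwise (Linked.tail ↗xs) (Linked.tail ↗ys) |xs′|≡|ys′| tail-counts≤
  where
  |xs′|≡|ys′| : length xs ≡ length ys
  |xs′|≡|ys′| = suc-injective |xs|≡|ys|

  count-tail : ∀ {z zs v} → Linked _≤_ (z ∷ zs) → v ≤ z → count v zs ≡ length zs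
  count-tail ↗zs v≤z = count-all (All.tail (Linked⇒All ≤-trans v≤z ↗zs))

  x≤y : x ≤ y
  x≤y = ≮⇒≥ λ y<x → 1+n≰n (begin
    suc (length xs)    ≡⟨ cong₂ _+_ (𝟙-≤ ≤-refl) (count-tail ↗xs ≤-refl) ⟨
    count x (x ∷ xs)   ≤⟨ counts≤ x ⟩
    count x (y ∷ ys)   ≡⟨ cong (_+ count x ys) (𝟙-> y<x) ⟩
    count x ys         ≤⟨ count≤length x ys ⟩
    length ys          ≡⟨ |xs′|≡|ys′| ⟨
    length xs          ∎)
    where open ≤-Reasoning

  tail-counts≤ : ∀ v → count v xs ≤ count v ys
  tail-counts≤ v with v ≤? x | v ≤? y
  ... | yes v≤x | _ = +-cancelˡ-≤ 1 _ _
    (subst₂ _≤_ (cong (_+ count v xs) (𝟙-≤ v≤x)) (cong (_+ count v ys) (𝟙-≤ (≤-trans v≤x x≤y)))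
            (counts≤ v))
  ... | no _ | yes v≤y = begin
    count v xs   ≤⟨ count≤length v xs ⟩
    length xs    ≡⟨ |xs′|≡|ys′| ⟩
    length ys    ≡⟨ count-tail ↗ys v≤y ⟨
    count v ys   ∎
    where open ≤-Reasoning
  ... | no v≰x | no v≰y =
    subst₂ _≤_ (cong (_+ count v xs) (𝟙-> (≰⇒> v≰x))) (cong (_+ count v ys) (𝟙-> (≰⇒> v≰y)))
           (counts≤ v)

rank : (ℕ → ℕ) → ℕ → ℕ → ℕ
rank f zero v = 0
rank f (suc n) v = rank f n v + 𝟙[ v ≤ f n ]

count-map-upTo : ∀ f n v → count v (map f (upTo n)) ≡ rank f n v
count-map-upTo f zero v = refl
count-map-upTo f (suc n) v = begin
  count v (map f (upTo (suc n)))                 ≡⟨ cong (count v ∘ map f) (upTo-∷ʳ n) ⟨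
  count v (map f (upTo n ++ [ n ]))              ≡⟨ cong (count v) (map-++ f (upTo n) [ n ]) ⟩
  count v (map f (upTo n) ++ [ f n ])            ≡⟨ count-++ v (map f (upTo n)) [ f n ] ⟩
  count v (map f (upTo n)) + (𝟙[ v ≤ f n ] + 0)
    ≡⟨ cong₂ _+_ (count-map-upTo f n v) (+-identityʳ _) ⟩
  rank f n v + 𝟙[ v ≤ f n ]                      ∎
  where open ≡-Reasoning

count-sortedPrefix : ∀ f n v → count v (sortedPrefix f n) ≡ rank f n v
count-sortedPrefix f n v = trans (count-↭ v (sort-↭ (map f (upTo n)))) (count-map-upTo f n v)

length-sortedPrefix : ∀ f n → length (sortedPrefix f n) ≡ n
length-sortedPrefix f n =
  trans (↭-length (sort-↭ (map f (upTo n)))) (trans (length-map f (upTo n)) (length-upTo n))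

≤B⇒rank≤ : ∀ {f g} → f ≤B g → ∀ n v → rank f n v ≤ rank g n v
≤B⇒rank≤ {f} {g} f≤g n v =
  subst₂ _≤_ (count-sortedPrefix f n v) (count-sortedPrefix g n v) (count-mono v (f≤g n))

rank≤⇒≤B : ∀ {f g} → (∀ n v → rank f n v ≤ rank g n v) → f ≤B g
rank≤⇒≤B {f} {g} ranks≤ n =
  count≤⇒pointwise (sort-↗ (map f (upTo n))) (sort-↗ (map g (upTo n)))
    (trans (length-sortedPrefix f n) (sym (length-sortedPrefix g n)))
    λ v → subst₂ _≤_ (sym (count-sortedPrefix f n v)) (sym (count-sortedPrefix g n v))
                     (ranks≤ n v)

rank-cong : ∀ {f g} n v → (∀ i → i < n → f i ≡ g i) → rank f n v ≡ rank g n v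
rank-cong zero v _ = refl
rank-cong (suc n) v f≡g =
  cong₂ _+_ (rank-cong n v (λ i i<n → f≡g i (m<n⇒m<1+n i<n))) (cong 𝟙[ v ≤_] (f≡g n ≤-refl))

rank≡⇒𝟙≡ : ∀ {f g n v} → rank f n v ≡ rank g n v → rank f (suc n) v ≡ rank g (suc n) v →
           𝟙[ v ≤ f n ] ≡ 𝟙[ v ≤ g n ]
rank≡⇒𝟙≡ {f} {g} {n} {v} rank≡ rank′≡ =
  +-cancelˡ-≡ (rank f n v) _ _ (trans rank′≡ (cong (_+ 𝟙[ v ≤ g n ]) (sym rank≡)))

rank-+ : ∀ f k d v → rank f (k + d) v ≡ rank f d v + rank (λ i → f (i + d)) k v
rank-+ f zero d v = sym (+-identityʳ _)
rank-+ f (suc k) d v =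
  trans (cong (_+ 𝟙[ v ≤ f (k + d) ]) (rank-+ f k d v)) (+-assoc (rank f d v) _ _)

rank-antimono : ∀ f n {v w} → v ≤ w → rank f n w ≤ rank f n v
rank-antimono f zero v≤w = z≤n
rank-antimono f (suc n) v≤w = +-mono-≤ (rank-antimono f n v≤w) (𝟙-antimonoˡ-≤ (f n) v≤w)

rank-antimono-strict : ∀ f {n j v w} → j < n → v ≤ f j → f j < w → rank f n w < rank f n v
rank-antimono-strict f {suc n} {j} {v} {w} j<1+n v≤fj fj<w with m<1+n⇒m<n∨m≡n j<1+n
... | inj₁ j<n = +-mono-<-≤ (rank-antimono-strict f j<n v≤fj fj<w) (𝟙-antimonoˡ-≤ (f n) v≤w)
  where v≤w = <⇒≤ (≤-<-trans v≤fj fj<w)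
... | inj₂ refl = +-mono-≤-< (rank-antimono f j v≤w) 𝟙<𝟙
  where
  v≤w = <⇒≤ (≤-<-trans v≤fj fj<w)
  𝟙<𝟙 : 𝟙[ w ≤ f j ] < 𝟙[ v ≤ f j ]
  𝟙<𝟙 = subst₂ _<_ (sym (𝟙-> fj<w)) (sym (𝟙-≤ v≤fj)) z<s

rank-constant : ∀ f n {v w} → v ≤ w → (∀ i → i < n → f i < v ⊎ w ≤ f i) → rank f n v ≡ rank f n w
rank-constant f zero v≤w _ = refl
rank-constant f (suc n) {v} {w} v≤w avoids =
  cong₂ _+_ (rank-constant f n v≤w (λ i i<n → avoids i (m<n⇒m<1+n i<n))) (𝟙≡ (avoids n ≤-refl))
  where
  𝟙≡ : f n < v ⊎ w ≤ f n → 𝟙[ v ≤ f n ] ≡ 𝟙[ w ≤ f n ]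
  𝟙≡ (inj₁ fn<v) = trans (𝟙-> fn<v) (sym (𝟙-> (<-≤-trans fn<v v≤w)))
  𝟙≡ (inj₂ w≤fn) = trans (𝟙-≤ (≤-trans v≤w w≤fn)) (sym (𝟙-≤ w≤fn))

rank-gain : ∀ {s w : ℕ → ℕ} {d n v} →
            (∀ i → i < d → s i ≡ w i) → (∀ n v → rank s n v ≤ rank w n v) → d < n →
            (∀ i → d ≤ i → i < n → s i < v ⊎ w d < s i) → v ≤ w d →
            rank s n v < rank w n v
rank-gain {s} {w} {d} {n} {v} agree s≤w d<n avoids v≤wd =
  subst (λ n → rank s n v < rank w n v) k+d≡n (begin-strict
    rank s (k + d) v           ≡⟨ rank-+ s k d v ⟩
    rank s d v + rank s′ k v   ≡⟨ cong₂ _+_ (rank-cong d v agree) (rank-constant s′ k v≤c′ s′-avoids) ⟩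
    rank w d v + rank s′ k c′  ≤⟨ +-monoʳ-≤ (rank w d v) window-≤ ⟩
    rank w d v + rank w′ k c′  <⟨ +-monoʳ-< (rank w d v) (rank-antimono-strict w′ 0<k v≤wd ≤-refl) ⟩
    rank w d v + rank w′ k v   ≡⟨ rank-+ w k d v ⟨
    rank w (k + d) v           ∎)
  where
  open ≤-Reasoning
  k c′ : ℕ
  k = n ∸ d
  c′ = suc (w d)
  s′ w′ : ℕ → ℕ
  s′ i = s (i + d)
  w′ i = w (i + d)

  v≤c′ : v ≤ c′
  v≤c′ = m≤n⇒m≤1+n v≤wd

  0<k : 0 < k
  0<k = m<n⇒0<n∸m d<n

  k+d≡n : k + d ≡ n
  k+d≡n = m∸n+n≡m (<⇒≤ d<n)

  s′-avoids : ∀ i → i < k → s′ i < v ⊎ c′ ≤ s′ i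
  s′-avoids i i<k = avoids (i + d) (m≤n+m d i) (<-≤-trans (+-monoˡ-< d i<k) (≤-reflexive k+d≡n))

  window-≤ : rank s′ k c′ ≤ rank w′ k c′
  window-≤ = +-cancelˡ-≤ (rank w d c′) _ _ (begin
    rank w d c′ + rank s′ k c′  ≡⟨ cong (_+ rank s′ k c′) (rank-cong d c′ agree) ⟨
    rank s d c′ + rank s′ k c′  ≡⟨ rank-+ s k d c′ ⟨
    rank s (k + d) c′           ≤⟨ s≤w (k + d) c′ ⟩
    rank w (k + d) c′           ≡⟨ rank-+ w k d c′ ⟩
    rank w d c′ + rank w′ k c′  ∎)

swap-≡ˡ : ∀ p q → swap p q p ≡ q
swap-≡ˡ p q with p ≟ p
... | yes _ = refl
... | no p≢p = contradiction refl p≢p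

swap-≡ʳ : ∀ p q → swap p q q ≡ p
swap-≡ʳ p q with q ≟ p
... | yes q≡p = q≡p
... | no _ with q ≟ q
...   | yes _ = refl
...   | no q≢q = contradiction refl q≢q

swap-≢ : ∀ {p q i} → i ≢ p → i ≢ q → swap p q i ≡ i
swap-≢ {p} {q} {i} i≢p i≢q with i ≟ p
... | yes i≡p = contradiction i≡p i≢p
... | no _ with i ≟ q
...   | yes i≡q = contradiction i≡q i≢q
...   | no _ = refl

module Transposition (s : ℕ → ℕ) {p q : ℕ} (p<q : p < q) where

  t : ℕ → ℕ
  t = s ∘t[ p , q ]

  t-p : t p ≡ s q
  t-p = cong s (swap-≡ˡ p q)

  t-q : t q ≡ s p
  t-q = cong s (swap-≡ʳ p q)

  t-other : ∀ {i} → i ≢ p → i ≢ q → t i ≡ s i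
  t-other i≢p i≢q = cong s (swap-≢ i≢p i≢q)

  rank-swap-below : ∀ {n} v → n ≤ p → rank t n v ≡ rank s n v
  rank-swap-below v n≤p = rank-cong _ v λ i i<n →
    t-other (<⇒≢ (<-≤-trans i<n n≤p)) (<⇒≢ (<-trans (<-≤-trans i<n n≤p) p<q))

  rank-swap-between : ∀ n v → p < n → n ≤ q → rank t n v + 𝟙[ v ≤ s p ] ≡ rank s n v + 𝟙[ v ≤ s q ]
  rank-swap-between (suc n) v p<1+n 1+n≤q with m<1+n⇒m<n∨m≡n p<1+n
  ... | inj₂ refl = begin
    rank t p v + 𝟙[ v ≤ t p ] + 𝟙[ v ≤ s p ]
      ≡⟨ cong₂ (λ r x → r + 𝟙[ v ≤ x ] + 𝟙[ v ≤ s p ]) (rank-swap-below v ≤-refl) t-p ⟩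
    rank s p v + 𝟙[ v ≤ s q ] + 𝟙[ v ≤ s p ]  ≡⟨ xy∙z≈xz∙y (rank s p v) _ _ ⟩
    rank s p v + 𝟙[ v ≤ s p ] + 𝟙[ v ≤ s q ]  ∎
    where open ≡-Reasoning
  ... | inj₁ p<n = begin
    rank t n v + 𝟙[ v ≤ t n ] + 𝟙[ v ≤ s p ]
      ≡⟨ cong (λ x → rank t n v + 𝟙[ v ≤ x ] + 𝟙[ v ≤ s p ]) (t-other (>⇒≢ p<n) (<⇒≢ 1+n≤q)) ⟩
    rank t n v + 𝟙[ v ≤ s n ] + 𝟙[ v ≤ s p ]  ≡⟨ xy∙z≈xz∙y (rank t n v) _ _ ⟩
    rank t n v + 𝟙[ v ≤ s p ] + 𝟙[ v ≤ s n ]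
      ≡⟨ cong (_+ 𝟙[ v ≤ s n ]) (rank-swap-between n v p<n (<⇒≤ 1+n≤q)) ⟩
    rank s n v + 𝟙[ v ≤ s q ] + 𝟙[ v ≤ s n ]  ≡⟨ xy∙z≈xz∙y (rank s n v) _ _ ⟩
    rank s n v + 𝟙[ v ≤ s n ] + 𝟙[ v ≤ s q ]  ∎
    where open ≡-Reasoning

  rank-swap-above : ∀ n v → q < n → rank t n v ≡ rank s n v
  rank-swap-above (suc n) v q<1+n with m<1+n⇒m<n∨m≡n q<1+n
  ... | inj₂ refl =
    trans (cong (λ x → rank t q v + 𝟙[ v ≤ x ]) t-q) (rank-swap-between q v p<q ≤-refl)
  ... | inj₁ q<n = cong₂ _+_ (rank-swap-above n v q<n)
    (cong 𝟙[ v ≤_] (t-other (>⇒≢ (<-trans p<q q<n)) (>⇒≢ q<n)))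

  InBox : ℕ → ℕ → Set
  InBox n v = (p < n × n ≤ q) × (s p < v × v ≤ s q)

  inBox? : ∀ n v → Dec (InBox n v)
  inBox? n v = (p <? n ×-dec n ≤? q) ×-dec (s p <? v ×-dec v ≤? s q)

  rank-swap-inside : ∀ {n v} → InBox n v → rank t n v ≡ suc (rank s n v)
  rank-swap-inside {n} {v} ((p<n , n≤q) , (sp<v , v≤sq)) = begin
    rank t n v                  ≡⟨ +-identityʳ _ ⟨
    rank t n v + 0              ≡⟨ cong (rank t n v +_) (𝟙-> sp<v) ⟨
    rank t n v + 𝟙[ v ≤ s p ]   ≡⟨ rank-swap-between n v p<n n≤q ⟩
    rank s n v + 𝟙[ v ≤ s q ]   ≡⟨ cong (rank s n v +_) (𝟙-≤ v≤sq) ⟩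
    rank s n v + 1              ≡⟨ +-comm _ 1 ⟩
    suc (rank s n v)            ∎
    where open ≡-Reasoning

  module Ascending (sp<sq : s p < s q) where

    rank-swap-outside : ∀ {n v} → ¬ InBox n v → rank t n v ≡ rank s n v
    rank-swap-outside {n} {v} ∉box with n ≤? p | q <? n
    ... | yes n≤p | _ = rank-swap-below v n≤p
    ... | no _ | yes q<n = rank-swap-above n v q<n
    ... | no n≰p | no q≮n = +-cancelʳ-≡ 𝟙[ v ≤ s p ] _ _
      (trans (rank-swap-between n v p<n n≤q) (cong (rank s n v +_) (𝟙≡𝟙 (v ≤? s p))))
      where
      p<n : p < n
      p<n = ≰⇒> n≰p
      n≤q : n ≤ q
      n≤q = ≮⇒≥ q≮n
      𝟙≡𝟙 : Dec (v ≤ s p) → 𝟙[ v ≤ s q ] ≡ 𝟙[ v ≤ s p ]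
      𝟙≡𝟙 (yes v≤sp) = trans (𝟙-≤ (≤-trans v≤sp (<⇒≤ sp<sq))) (sym (𝟙-≤ v≤sp))
      𝟙≡𝟙 (no v≰sp) = trans (𝟙-> (≰⇒> λ v≤sq → ∉box ((p<n , n≤q) , (≰⇒> v≰sp , v≤sq))))
                             (sym (𝟙-> (≰⇒> v≰sp)))

    rank-swap-≥ : ∀ n v → rank s n v ≤ rank t n v
    rank-swap-≥ n v with inBox? n v
    ... | yes ∈box = ≤-trans (n≤1+n _) (≤-reflexive (sym (rank-swap-inside ∈box)))
    ... | no ∉box = ≤-reflexive (sym (rank-swap-outside ∉box))

    <B-swap : s <B t
    <B-swap = rank≤⇒≤B rank-swap-≥ , λ s≗t → <⇒≢ sp<sq (trans (s≗t p) t-p)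

    swap-≤B : ∀ {w} → s ≤B w → (∀ {n v} → InBox n v → rank s n v < rank w n v) → t ≤B w
    swap-≤B {w} s≤w inBox⇒< = rank≤⇒≤B λ n v → by-box n v (inBox? n v)
      where
      by-box : ∀ n v → Dec (InBox n v) → rank t n v ≤ rank w n v
      by-box n v (yes ∈box) = ≤-trans (≤-reflexive (rank-swap-inside ∈box)) (inBox⇒< ∈box)
      by-box n v (no ∉box) = ≤-trans (≤-reflexive (rank-swap-outside ∉box)) (≤B⇒rank≤ s≤w n v)

injective : (σ : S∞) → ∀ {x y} → ⟦ σ ⟧ x ≡ ⟦ σ ⟧ y → x ≡ y
injective σ = Injection.injective (↔⇒↣ σ)

≗-from-pair : ∀ {f g : ℕ → ℕ} {p q} → f p ≡ g p → f q ≡ g q →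
              (∀ i → i ≢ p → i ≢ q → f i ≡ g i) → f ≗ g
≗-from-pair {p = p} {q} fp≡gp fq≡gq f≡g-off i with i ≟ p | i ≟ q
... | yes refl | _ = fp≡gp
... | no _ | yes refl = fq≡gq
... | no i≢p | no i≢q = f≡g-off i i≢p i≢q

module _ (ρ σ : S∞) {p q : ℕ} (ρ≡σ-off : ∀ i → i ≢ p → i ≢ q → ⟦ ρ ⟧ i ≡ ⟦ σ ⟧ i) where

  values-on-pair : ∀ {j} → j ≡ p ⊎ j ≡ q → ⟦ ρ ⟧ j ≡ ⟦ σ ⟧ p ⊎ ⟦ ρ ⟧ j ≡ ⟦ σ ⟧ q
  values-on-pair {j} j∈pq = by-preimage (k ≟ p) (k ≟ q)
    where
    k : ℕ
    k = σ ⁻¹⟦ ⟦ ρ ⟧ j ⟧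
    σk≡ρj : ⟦ σ ⟧ k ≡ ⟦ ρ ⟧ j
    σk≡ρj = Inverse.strictlyInverseˡ σ (⟦ ρ ⟧ j)
    by-preimage : Dec (k ≡ p) → Dec (k ≡ q) → ⟦ ρ ⟧ j ≡ ⟦ σ ⟧ p ⊎ ⟦ ρ ⟧ j ≡ ⟦ σ ⟧ q
    by-preimage (yes k≡p) _ = inj₁ (trans (sym σk≡ρj) (cong ⟦ σ ⟧ k≡p))
    by-preimage (no _) (yes k≡q) = inj₂ (trans (sym σk≡ρj) (cong ⟦ σ ⟧ k≡q))
    by-preimage (no k≢p) (no k≢q) = contradiction j∈pq Sum.[ k≢p ∘ trans k≡j , k≢q ∘ trans k≡j ]
      where
      k≡j : k ≡ j
      k≡j = injective ρ (trans (ρ≡σ-off k k≢p k≢q) σk≡ρj)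

  ≗⊎≗swap : p ≢ q → ⟦ ρ ⟧ ≗ ⟦ σ ⟧ ⊎ ⟦ ρ ⟧ ≗ ⟦ σ ⟧ ∘t[ p , q ]
  ≗⊎≗swap p≢q with values-on-pair (inj₁ refl) | values-on-pair (inj₂ refl)
  ... | inj₁ ρp≡σp | inj₁ ρq≡σp = contradiction (injective ρ (trans ρp≡σp (sym ρq≡σp))) p≢q
  ... | inj₂ ρp≡σq | inj₂ ρq≡σq = contradiction (injective ρ (trans ρp≡σq (sym ρq≡σq))) p≢q
  ... | inj₁ ρp≡σp | inj₂ ρq≡σq = inj₁ (≗-from-pair ρp≡σp ρq≡σq ρ≡σ-off)
  ... | inj₂ ρp≡σq | inj₁ ρq≡σp = inj₂ (≗-from-pair
    (trans ρp≡σq (cong ⟦ σ ⟧ (sym (swap-≡ˡ p q))))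
    (trans ρq≡σp (cong ⟦ σ ⟧ (sym (swap-≡ʳ p q))))
    (λ i i≢p i≢q → trans (ρ≡σ-off i i≢p i≢q) (cong ⟦ σ ⟧ (sym (swap-≢ i≢p i≢q)))))

module _ (σ : S∞) {p q : ℕ} (p<q : p < q) (σp<σq : ⟦ σ ⟧ p < ⟦ σ ⟧ q)
         (gap : ∀ i → p < i → i < q → ⟦ σ ⟧ i < ⟦ σ ⟧ p ⊎ ⟦ σ ⟧ q < ⟦ σ ⟧ i) where

  open Transposition ⟦ σ ⟧ p<q
  open Ascending σp<σq

  separated : ∀ {i} → i ≢ p → i ≢ q →
              (suc i ≤ p ⊎ q < i) ⊎ (suc (⟦ σ ⟧ i) ≤ ⟦ σ ⟧ p ⊎ ⟦ σ ⟧ q < ⟦ σ ⟧ i)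
  separated {i} i≢p i≢q with <-cmp i p | <-cmp i q
  ... | tri< i<p _ _ | _ = inj₁ (inj₁ i<p)
  ... | tri≈ _ i≡p _ | _ = contradiction i≡p i≢p
  ... | tri> _ _ p<i | tri< i<q _ _ = inj₂ (gap i p<i i<q)
  ... | tri> _ _ _ | tri≈ _ i≡q _ = contradiction i≡q i≢q
  ... | tri> _ _ _ | tri> _ _ q<i = inj₁ (inj₂ q<i)

  ∉box-near : ∀ {i n v} → i ≢ p → i ≢ q → i ≤ n → n ≤ suc i →
              ⟦ σ ⟧ i ≤ v → v ≤ suc (⟦ σ ⟧ i) → ¬ InBox n v
  ∉box-near i≢p i≢q i≤n n≤1+i σi≤v v≤1+σi ((p<n , n≤q) , (σp<v , v≤σq)) with separated i≢p i≢q
  ... | inj₁ (inj₁ 1+i≤p) = <⇒≱ p<n (≤-trans n≤1+i 1+i≤p)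
  ... | inj₁ (inj₂ q<i) = <⇒≱ (<-≤-trans q<i i≤n) n≤q
  ... | inj₂ (inj₁ 1+σi≤σp) = <⇒≱ σp<v (≤-trans v≤1+σi 1+σi≤σp)
  ... | inj₂ (inj₂ σq<σi) = <⇒≱ (<-≤-trans σq<σi σi≤v) v≤σq

  ≡-off-pair : ∀ (ρ : S∞) → ⟦ σ ⟧ ≤B ⟦ ρ ⟧ → ⟦ ρ ⟧ ≤B t → ∀ i → i ≢ p → i ≢ q → ⟦ ρ ⟧ i ≡ ⟦ σ ⟧ i
  ≡-off-pair ρ σ≤ρ ρ≤t i i≢p i≢q = 𝟙≡𝟙⇒≡ (𝟙≡𝟙 ≤-refl (n≤1+n _)) (𝟙≡𝟙 (n≤1+n _) ≤-refl)
    where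
    rank≡ : ∀ {n v} → ¬ InBox n v → rank ⟦ ρ ⟧ n v ≡ rank ⟦ σ ⟧ n v
    rank≡ {n} {v} ∉box = ≤-antisym
      (≤-trans (≤B⇒rank≤ ρ≤t n v) (≤-reflexive (rank-swap-outside ∉box))) (≤B⇒rank≤ σ≤ρ n v)
    𝟙≡𝟙 : ∀ {v} → ⟦ σ ⟧ i ≤ v → v ≤ suc (⟦ σ ⟧ i) → 𝟙[ v ≤ ⟦ ρ ⟧ i ] ≡ 𝟙[ v ≤ ⟦ σ ⟧ i ]
    𝟙≡𝟙 σi≤v v≤1+σi = rank≡⇒𝟙≡ {⟦ ρ ⟧} {⟦ σ ⟧}
      (rank≡ (∉box-near i≢p i≢q ≤-refl (n≤1+n i) σi≤v v≤1+σi))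
      (rank≡ (∉box-near i≢p i≢q (n≤1+n i) ≤-refl σi≤v v≤1+σi))

  ⋖B-swap : ⟦ σ ⟧ ⋖B t
  ⋖B-swap = <B-swap , strictly-between
    where
    strictly-between : ∀ ρ → ⟦ σ ⟧ <B ⟦ ρ ⟧ → ⟦ ρ ⟧ <B t → ⊥
    strictly-between ρ (σ≤ρ , σ≢ρ) (ρ≤t , ρ≢t) with ≗⊎≗swap ρ σ (≡-off-pair ρ σ≤ρ ρ≤t) (<⇒≢ p<q)
    ... | inj₁ ρ≗σ = σ≢ρ (sym ∘ ρ≗σ)
    ... | inj₂ ρ≗t = ρ≢t ρ≗t

IsD⇒agree : ∀ σ ω {d} → IsD σ ω d → ∀ i → i < d → ⟦ σ ⟧ i ≡ ⟦ ω ⟧ i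
IsD⇒agree σ ω (_ , least) i i<d = decidable-stable (⟦ σ ⟧ i ≟ ⟦ ω ⟧ i) (least i i<d)

IsM⇒gap : ∀ σ ω {d m} → IsM σ ω d m →
          ∀ i → d < i → i < m → ⟦ σ ⟧ i < ⟦ σ ⟧ d ⊎ ⟦ σ ⟧ (fOf σ ω d) < ⟦ σ ⟧ i
IsM⇒gap σ ω {d} (((_ , m≤f) , _) , least) i d<i i<m
  with ⟦ σ ⟧ d <? ⟦ σ ⟧ i | ⟦ σ ⟧ i ≤? ⟦ σ ⟧ (fOf σ ω d)
... | no σd≮σi | _ = inj₁ (≤∧≢⇒< (≮⇒≥ σd≮σi) (>⇒≢ d<i ∘ injective σ))
... | yes σd<σi | yes σi≤σf =
  contradiction ((d<i , ≤-trans (<⇒≤ i<m) m≤f) , (σd<σi , σi≤σf)) (least i i<m)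
... | yes _ | no σi≰σf = inj₂ (≰⇒> σi≰σf)

mainTheorem14 : (σ ω : S∞) → ⟦ σ ⟧ <B ⟦ ω ⟧ →
    (d : ℕ) → IsD σ ω d → (m : ℕ) → IsM σ ω d m →
    RelativeCandidate σ ω d m
mainTheorem14 σ ω (σ≤ω , _) d isD m isM@(((d<m , _) , (σd<σm , σm≤σf)) , _) =
  d<m , ⋖B-swap σ d<m σd<σm gap-below-σm , swap-≤B σ≤ω box-strict
  where
  open Transposition ⟦ σ ⟧ d<m
  open Ascending σd<σm

  σf≡ωd : ⟦ σ ⟧ (fOf σ ω d) ≡ ⟦ ω ⟧ d
  σf≡ωd = Inverse.strictlyInverseˡ σ (⟦ ω ⟧ d)

  gap-below-σm : ∀ i → d < i → i < m → ⟦ σ ⟧ i < ⟦ σ ⟧ d ⊎ ⟦ σ ⟧ m < ⟦ σ ⟧ i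
  gap-below-σm i d<i i<m = Sum.map₂ (≤-<-trans σm≤σf) (IsM⇒gap σ ω isM i d<i i<m)

  box-strict : ∀ {n v} → InBox n v → rank ⟦ σ ⟧ n v < rank ⟦ ω ⟧ n v
  box-strict {n} {v} ((d<n , n≤m) , (σd<v , v≤σm)) = rank-gain (IsD⇒agree σ ω isD) (≤B⇒rank≤ σ≤ω)
    d<n avoids (≤-trans v≤σm (≤-trans σm≤σf (≤-reflexive σf≡ωd)))
    where
    avoids : ∀ i → d ≤ i → i < n → ⟦ σ ⟧ i < v ⊎ ⟦ ω ⟧ d < ⟦ σ ⟧ i
    avoids i d≤i i<n with m≤n⇒m<n∨m≡n d≤i
    ... | inj₂ refl = inj₁ σd<v
    ... | inj₁ d<i = Sum.map (λ σi<σd → <-trans σi<σd σd<v) (subst (_< ⟦ σ ⟧ i) σf≡ωd)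
                             (IsM⇒gap σ ω isM i d<i (<-≤-trans i<n n≤m))
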